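{- Let $u,v\in\mathbb{P}^*$ with $u\sim_s v$. Then (a) $1u\sim_s 1v$; (b) $1u\sim_s v1$; (c) $u^+\sim_s v^+$.
   Context: $\mathbb{P}$ is the positive integers; $\mathbb{P}^*$ the finite words over $\mathbb{P}$. Generalized factor order: $u\le w$ iff there is a factor $w'$ of $w$ (consecutive letters) with $|w'|=|u|$ and $u_i\le w'_i$ for all $i$; if $w'$ starts at the $j$th letter of $w$, $j$ is an embedding index. $\mathrm{Em}(u,w)$ is the set of embedding indices of $u$ into $w$. The weight of $w=w_1\cdots w_\ell$ is $t^\ell x^{w_1+\cdots+w_\ell}$. $u,v$ are strongly Wilf equivalent, $u\sim_s v$, if there is a weight-preserving bijection $f:\mathbb{P}^*\to\mathbb{P}^*$ with $\mathrm{Em}(u,w)=\mathrm{Em}(v,f(w))$ for all $w$. $1u$ ($u1$) is $u$ with the letter 1 prepended (appended); $u^+$ adds 1 to every letter of $u$. -}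

module Defs where

open import Data.Nat using (ℕ; zero; suc; _+_; _∸_; _≤_; NonZero)
open import Data.List using (List; []; _∷_; length; drop; map; [_]; _++_)
open import Data.Nat.ListAction using (sum)
open import Data.Product using (Σ; _×_; _,_)
open import Data.Unit using (⊤)
open import Data.Empty using (⊥)
open import Function.Bundles using (Bijection; _⇔_)
open import Relation.Binary.PropositionalEquality using (_≡_)
import Relation.Binary.PropositionalEquality

record ℙ : Set where
  constructor mkℙ
  field
    val : ℕ
    .{{nonZero}} : NonZero val
open ℙ public

one : ℙ
one = mkℙ 1

succℙ : ℙ → ℙ
succℙ (mkℙ n) = mkℙ (suc n)

_≤ℙ_ : ℙ → ℙ → Set
a ≤ℙ b = val a ≤ val b

Word : Set
Word = List ℙ

PrefixDom : Word → Word → Set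
PrefixDom [] w = ⊤
PrefixDom (a ∷ u) [] = ⊥
PrefixDom (a ∷ u) (b ∷ w) = (a ≤ℙ b) × PrefixDom u w

-- j is an embedding index of u into w (indices are 1-based):
-- the factor of w starting at its j-th letter of length |u| dominates u.
Emb : Word → Word → ℕ → Set
Emb u w zero = ⊥
Emb u w (suc k) = PrefixDom u (drop k w)

letterSum : Word → ℕ
letterSum w = sum (map val w)

-- weight t^ℓ x^{w₁+⋯+w_ℓ}, recorded as the pair of exponents (ℓ , Σ wᵢ)
weight : Word → ℕ × ℕ
weight w = length w , letterSum w

_∼s_ : Word → Word → Set
u ∼s v = Σ (Bijection (Relation.Binary.PropositionalEquality.setoid Word)
                      (Relation.Binary.PropositionalEquality.setoid Word)) λ f →
           (∀ w → weight (Bijection.to f w) ≡ weight w) ×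
           (∀ w j → Emb u w j ⇔ Emb v (Bijection.to f w) j)

1∷ : Word → Word
1∷ u = one ∷ u

∷1 : Word → Word
∷1 u = u ++ [ one ]

_⁺ : Word → Word
u ⁺ = map succℙ u

infix 4 _∼s_
infix 30 _⁺

-- (a) Extend the bijection by keeping the first letter: as 1 is the least letter, 1u occurs at
-- position k of a·w exactly when u occurs at position k of w and that position exists.
-- (b) Moving the first letter to the end turns occurrences of 1v into occurrences of v1, so
-- 1v ∼s v1, and (b) follows from (a) by transitivity.
-- (c) Every word factors uniquely as y₀⁺ 1 y₁⁺ 1 ⋯ 1 yₙ⁺. An occurrence of u⁺ cannot cover a
-- letter 1, so it lies inside a single block yᵢ⁺ and is an occurrence of u in yᵢ; applying the
-- bijection blockwise therefore works, and it preserves weight because x ↦ x⁺ adds |x| to the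
-- letter sum.

module Submission where

open import Defs

open import Algebra.Properties.CommutativeSemigroup using (x∙yz≈y∙xz)
open import Data.Empty using (⊥-elim; ⊥-elim-irr)
open import Data.List using (List; []; _∷_; length; drop; map; [_]; _++_)
open import Data.List.Properties using (drop-map; drop-[]; length-++; length-map; map-++; map-∘; map-cong; map-id; ++-identityʳ)
open import Data.Nat using (ℕ; zero; suc; _+_; _∸_; _≤_; _<_; z≤n; s≤s; s≤s⁻¹; _≤?_; NonZero)
open import Data.Nat.ListAction using (sum)
open import Data.Nat.ListAction.Properties using (sum-++)
open import Data.Nat.Properties using (≤-refl; ≤-trans; ≤⇒≯; ≰⇒>; +-comm; +-commutativeSemigroup)
open import Data.Product using (_×_; _,_; proj₁; proj₂; uncurry; map₁)
open import Data.Product.Function.NonDependent.Propositional using (_×-⇔_)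
open import Data.Sum using (_⊎_; inj₁; inj₂)
open import Data.Sum.Function.Propositional using (_⊎-⇔_)
open import Data.Unit using (⊤; tt)
open import Function using (_∘_)
open import Function.Bundles using (Bijection; Inverse; Equivalence; _⇔_; _↔_; mk⇔; mk↔ₛ′)
open import Function.Construct.Composition using (_⇔-∘_)
open import Function.Construct.Identity using (⇔-id)
open import Function.Construct.Symmetry using (⇔-sym)
open import Function.Properties.Bijection using (⤖⇒↔)
open import Function.Properties.Inverse using (↔⇒⤖)
open import Function.Properties.Equivalence using (⇔-setoid)
open import Level using (0ℓ)
open import Relation.Binary.PropositionalEquality using (_≡_; refl; sym; trans; cong; cong₂; module ≡-Reasoning)
open import Relation.Nullary using (¬_; yes; no)

import Relation.Binary.Reasoning.Setoid as SetoidReasoning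
module ⇔-Reasoning = SetoidReasoning (⇔-setoid 0ℓ)

data Letter : ℙ → Set where
  is-one  : Letter one
  is-succ : (b : ℙ) → Letter (succℙ b)

letter : (a : ℙ) → Letter a
letter (mkℙ zero ⦃ nz ⦄)   = ⊥-elim-irr (NonZero.nonZero nz)
letter (mkℙ (suc zero))    = is-one
letter (mkℙ (suc (suc n))) = is-succ (mkℙ (suc n))

letter-succℙ : ∀ b → letter (succℙ b) ≡ is-succ b
letter-succℙ (mkℙ zero ⦃ nz ⦄) = ⊥-elim-irr (NonZero.nonZero nz)
letter-succℙ (mkℙ (suc n))     = refl

one≤ : ∀ a → one ≤ℙ a
one≤ a with letter a
... | is-one    = ≤-refl
... | is-succ _ = s≤s z≤n

succℙ≰one : ∀ b → ¬ succℙ b ≤ℙ one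
succℙ≰one b (s≤s b≤0) with () ← ≤-trans (one≤ b) b≤0

weight-++ : ∀ x y → weight (x ++ y) ≡ (length x + length y , letterSum x + letterSum y)
weight-++ x y = cong₂ _,_ (length-++ x) (trans (cong sum (map-++ val x y)) (sum-++ (map val x) (map val y)))

weight-++-cong : ∀ x x′ y y′ → weight x ≡ weight x′ → weight y ≡ weight y′ →
                 weight (x ++ y) ≡ weight (x′ ++ y′)
weight-++-cong x x′ y y′ x≈x′ y≈y′ = begin
  weight (x ++ y)                                     ≡⟨ weight-++ x y ⟩
  (length x + length y , letterSum x + letterSum y)   ≡⟨ cong₂ (λ (l , s) (l′ , s′) → l + l′ , s + s′) x≈x′ y≈y′ ⟩
  (length x′ + length y′ , letterSum x′ + letterSum y′) ≡⟨ weight-++ x′ y′ ⟨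
  weight (x′ ++ y′)                                   ∎
  where open ≡-Reasoning

weight-∷-cong : ∀ a x x′ → weight x ≡ weight x′ → weight (a ∷ x) ≡ weight (a ∷ x′)
weight-∷-cong a x x′ = cong (λ (l , s) → suc l , val a + s)

weight-++-comm : ∀ x y → weight (x ++ y) ≡ weight (y ++ x)
weight-++-comm x y = begin
  weight (x ++ y)                                   ≡⟨ weight-++ x y ⟩
  (length x + length y , letterSum x + letterSum y) ≡⟨ cong₂ _,_ (+-comm (length x) _) (+-comm (letterSum x) _) ⟩
  (length y + length x , letterSum y + letterSum x) ≡⟨ weight-++ y x ⟨
  weight (y ++ x)                                   ∎
  where open ≡-Reasoning

letterSum-⁺ : ∀ x → letterSum (x ⁺) ≡ length x + letterSum x
letterSum-⁺ []      = refl
letterSum-⁺ (a ∷ x) = cong suc (trans (cong (val a +_) (letterSum-⁺ x))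
                                       (x∙yz≈y∙xz +-commutativeSemigroup (val a) (length x) (letterSum x)))

weight-⁺ : ∀ x → weight (x ⁺) ≡ (length x , length x + letterSum x)
weight-⁺ x = cong₂ _,_ (length-map succℙ x) (letterSum-⁺ x)

weight-⁺-cong : ∀ x x′ → weight x ≡ weight x′ → weight (x ⁺) ≡ weight (x′ ⁺)
weight-⁺-cong x x′ x≈x′ =
  trans (weight-⁺ x) (trans (cong (λ (l , s) → l , l + s) x≈x′) (sym (weight-⁺ x′)))

-- Strong Wilf equivalence through an explicit inverse pair

record _≅s_ (u v : Word) : Set where
  field
    to           : Word → Word
    from         : Word → Word
    to-from      : ∀ w → to (from w) ≡ w
    from-to      : ∀ w → from (to w) ≡ w
    weight-to    : ∀ w → weight (to w) ≡ weight w
    prefixDom-to : ∀ k w → PrefixDom u (drop k w) ⇔ PrefixDom v (drop k (to w))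

  length-to : ∀ w → length (to w) ≡ length w
  length-to w = cong proj₁ (weight-to w)

infix 4 _≅s_

∼s⇒≅s : ∀ {u v} → u ∼s v → u ≅s v
∼s⇒≅s (f , weight-f , emb-f) = record
  { to           = Bijection.to f
  ; from         = Inverse.from f↔
  ; to-from      = Inverse.strictlyInverseˡ f↔
  ; from-to      = Inverse.strictlyInverseʳ f↔
  ; weight-to    = weight-f
  ; prefixDom-to = λ k w → emb-f w (suc k)
  }
  where
  f↔ : Word ↔ Word
  f↔ = ⤖⇒↔ f

≅s⇒∼s : ∀ {u v} → u ≅s v → u ∼s v
≅s⇒∼s {u} {v} e = ↔⇒⤖ (mk↔ₛ′ to from to-from from-to) , weight-to , emb-to
  where
  open _≅s_ e
  emb-to : ∀ w j → Emb u w j ⇔ Emb v (to w) j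
  emb-to w zero    = ⇔-id _
  emb-to w (suc k) = prefixDom-to k w

≅s-trans : ∀ {u v x} → u ≅s v → v ≅s x → u ≅s x
≅s-trans e e′ = record
  { to           = E′.to ∘ E.to
  ; from         = E.from ∘ E′.from
  ; to-from      = λ w → trans (cong E′.to (E.to-from (E′.from w))) (E′.to-from w)
  ; from-to      = λ w → trans (cong E.from (E′.from-to (E.to w))) (E.from-to w)
  ; weight-to    = λ w → trans (E′.weight-to (E.to w)) (E.weight-to w)
  ; prefixDom-to = λ k w → E′.prefixDom-to k (E.to w) ⇔-∘ E.prefixDom-to k w
  }
  where
  module E  = _≅s_ e
  module E′ = _≅s_ e′

-- Prepending and appending the letter 1

⇔-⊥ : ∀ {A B : Set} → ¬ A → ¬ B → A ⇔ B
⇔-⊥ ¬a ¬b = mk⇔ (⊥-elim ∘ ¬a) (⊥-elim ∘ ¬b)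

s≤s-⇔ : ∀ {m n} → m ≤ n ⇔ suc m ≤ suc n
s≤s-⇔ = mk⇔ s≤s s≤s⁻¹

prefixDom-1∷ : ∀ u k a w → PrefixDom (1∷ u) (drop k (a ∷ w)) ⇔ (k ≤ length w × PrefixDom u (drop k w))
prefixDom-1∷ u zero    a w       = mk⇔ (λ (_ , p) → z≤n , p) (λ (_ , p) → one≤ a , p)
prefixDom-1∷ u (suc k) a []      rewrite drop-[] {A = ℙ} k = ⇔-⊥ (λ ()) (λ { (() , _) })
prefixDom-1∷ u (suc k) a (b ∷ w) = (s≤s-⇔ ×-⇔ ⇔-id _) ⇔-∘ prefixDom-1∷ u k b w

¬prefixDom-∷1-[] : ∀ v → ¬ PrefixDom (∷1 v) []
¬prefixDom-∷1-[] []      ()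
¬prefixDom-∷1-[] (_ ∷ _) ()

prefixDom-∷1-++ : ∀ v x a → PrefixDom (∷1 v) (x ++ [ a ]) ⇔ PrefixDom v x
prefixDom-∷1-++ []      []      a = mk⇔ _ (λ _ → one≤ a , tt)
prefixDom-∷1-++ []      (c ∷ x) a = mk⇔ _ (λ _ → one≤ c , tt)
prefixDom-∷1-++ (b ∷ v) []      a = ⇔-⊥ (¬prefixDom-∷1-[] v ∘ proj₂) (λ ())
prefixDom-∷1-++ (b ∷ v) (c ∷ x) a = ⇔-id _ ×-⇔ prefixDom-∷1-++ v x a

prefixDom-∷1 : ∀ v k x a → PrefixDom (∷1 v) (drop k (x ++ [ a ])) ⇔ (k ≤ length x × PrefixDom v (drop k x))
prefixDom-∷1 v zero    x       a = mk⇔ (λ p → z≤n , Equivalence.to ∷1-++ p) (Equivalence.from ∷1-++ ∘ proj₂)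
  where
  ∷1-++ : PrefixDom (∷1 v) (x ++ [ a ]) ⇔ PrefixDom v x
  ∷1-++ = prefixDom-∷1-++ v x a
prefixDom-∷1 v (suc k) []      a rewrite drop-[] {A = ℙ} k = ⇔-⊥ (¬prefixDom-∷1-[] v) (λ { (() , _) })
prefixDom-∷1 v (suc k) (b ∷ x) a = (s≤s-⇔ ×-⇔ ⇔-id _) ⇔-∘ prefixDom-∷1 v k x a

1∷-cong : ∀ {u v} → u ≅s v → 1∷ u ≅s 1∷ v
1∷-cong {u} {v} e = record
  { to           = to
  ; from         = from
  ; to-from      = to-from
  ; from-to      = from-to
  ; weight-to    = weight-to
  ; prefixDom-to = prefixDom-to
  }
  where
  module E = _≅s_ e

  to from : Word → Word
  to []      = []
  to (a ∷ w) = a ∷ E.to w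
  from []      = []
  from (a ∷ w) = a ∷ E.from w

  to-from : ∀ w → to (from w) ≡ w
  to-from []      = refl
  to-from (a ∷ w) = cong (a ∷_) (E.to-from w)

  from-to : ∀ w → from (to w) ≡ w
  from-to []      = refl
  from-to (a ∷ w) = cong (a ∷_) (E.from-to w)

  weight-to : ∀ w → weight (to w) ≡ weight w
  weight-to []      = refl
  weight-to (a ∷ w) = weight-∷-cong a (E.to w) w (E.weight-to w)

  prefixDom-to : ∀ k w → PrefixDom (1∷ u) (drop k w) ⇔ PrefixDom (1∷ v) (drop k (to w))
  prefixDom-to k [] rewrite drop-[] {A = ℙ} k = ⇔-⊥ (λ ()) (λ ())
  prefixDom-to k (a ∷ w) = begin
    PrefixDom (1∷ u) (drop k (a ∷ w))                     ≈⟨ prefixDom-1∷ u k a w ⟩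
    (k ≤ length w × PrefixDom u (drop k w))                ≡⟨ cong (λ n → k ≤ n × _) (E.length-to w) ⟨
    (k ≤ length (E.to w) × PrefixDom u (drop k w))         ≈⟨ ⇔-id _ ×-⇔ E.prefixDom-to k w ⟩
    (k ≤ length (E.to w) × PrefixDom v (drop k (E.to w)))  ≈⟨ prefixDom-1∷ v k a (E.to w) ⟨
    PrefixDom (1∷ v) (drop k (a ∷ E.to w))                ∎
    where open ⇔-Reasoning

rotateˡ : ∀ {A : Set} → List A → List A
rotateˡ []      = []
rotateˡ (a ∷ x) = x ++ [ a ]

insertSecond : ∀ {A : Set} → A → List A → List A
insertSecond a []      = [ a ]
insertSecond a (b ∷ x) = b ∷ a ∷ x

rotateʳ : ∀ {A : Set} → List A → List A
rotateʳ []      = []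
rotateʳ (a ∷ x) = insertSecond a (rotateʳ x)

rotateʳ-∷ʳ : ∀ {A : Set} (x : List A) a → rotateʳ (x ++ [ a ]) ≡ a ∷ x
rotateʳ-∷ʳ []      a = refl
rotateʳ-∷ʳ (b ∷ x) a = cong (insertSecond b) (rotateʳ-∷ʳ x a)

rotateˡ-insertSecond : ∀ {A : Set} (a : A) x → rotateˡ (insertSecond a x) ≡ a ∷ rotateˡ x
rotateˡ-insertSecond a []      = refl
rotateˡ-insertSecond a (b ∷ x) = refl

rotateˡ-rotateʳ : ∀ {A : Set} (w : List A) → rotateˡ (rotateʳ w) ≡ w
rotateˡ-rotateʳ []      = refl
rotateˡ-rotateʳ (a ∷ x) = trans (rotateˡ-insertSecond a (rotateʳ x)) (cong (a ∷_) (rotateˡ-rotateʳ x))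

rotateʳ-rotateˡ : ∀ {A : Set} (w : List A) → rotateʳ (rotateˡ w) ≡ w
rotateʳ-rotateˡ []      = refl
rotateʳ-rotateˡ (a ∷ x) = rotateʳ-∷ʳ x a

1∷≅s∷1 : ∀ v → 1∷ v ≅s ∷1 v
1∷≅s∷1 v = record
  { to           = rotateˡ
  ; from         = rotateʳ
  ; to-from      = rotateˡ-rotateʳ
  ; from-to      = rotateʳ-rotateˡ
  ; weight-to    = weight-rotateˡ
  ; prefixDom-to = prefixDom-rotateˡ
  }
  where
  weight-rotateˡ : ∀ w → weight (rotateˡ w) ≡ weight w
  weight-rotateˡ []      = refl
  weight-rotateˡ (a ∷ x) = weight-++-comm x [ a ]

  prefixDom-rotateˡ : ∀ k w → PrefixDom (1∷ v) (drop k w) ⇔ PrefixDom (∷1 v) (drop k (rotateˡ w))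
  prefixDom-rotateˡ k []      rewrite drop-[] {A = ℙ} k = ⇔-⊥ (λ ()) (¬prefixDom-∷1-[] v)
  prefixDom-rotateˡ k (a ∷ x) = ⇔-sym (prefixDom-∷1 v k x a) ⇔-∘ prefixDom-1∷ v k a x

-- Raising every letter

unblocks : Word → List Word → Word
unblocks y []        = y ⁺
unblocks y (y′ ∷ ys) = y ⁺ ++ one ∷ unblocks y′ ys

blocks : Word → Word × List Word
blocks []      = [] , []
blocks (a ∷ w) with letter a
... | is-one    = [] , uncurry _∷_ (blocks w)
... | is-succ b = map₁ (b ∷_) (blocks w)

unblocks-∷ : ∀ b y ys → unblocks (b ∷ y) ys ≡ succℙ b ∷ unblocks y ys
unblocks-∷ b y []      = refl
unblocks-∷ b y (_ ∷ _) = refl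

unblocks-blocks : ∀ w → uncurry unblocks (blocks w) ≡ w
unblocks-blocks []      = refl
unblocks-blocks (a ∷ w) with letter a
... | is-one    = cong (one ∷_) (unblocks-blocks w)
... | is-succ b = trans (unblocks-∷ b (proj₁ (blocks w)) (proj₂ (blocks w))) (cong (succℙ b ∷_) (unblocks-blocks w))

blocks-unblocks : ∀ y ys → blocks (unblocks y ys) ≡ (y , ys)
blocks-unblocks []      []        = refl
blocks-unblocks []      (y′ ∷ ys) rewrite blocks-unblocks y′ ys = refl
blocks-unblocks (b ∷ y) ys rewrite unblocks-∷ b y ys | letter-succℙ b | blocks-unblocks y ys = refl

mapBlocks : (Word → Word) → Word → Word
mapBlocks f w = unblocks (f (proj₁ (blocks w))) (map f (proj₂ (blocks w)))

mapBlocks-inverse : ∀ {f g} → (∀ w → g (f w) ≡ w) → ∀ w → mapBlocks g (mapBlocks f w) ≡ w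
mapBlocks-inverse {f} {g} g∘f w = begin
  mapBlocks g (mapBlocks f w)             ≡⟨ cong (λ (z , zs) → unblocks (g z) (map g zs)) (blocks-unblocks (f y) (map f ys)) ⟩
  unblocks (g (f y)) (map g (map f ys))   ≡⟨ cong₂ unblocks (g∘f y) (trans (sym (map-∘ ys)) (trans (map-cong g∘f ys) (map-id ys))) ⟩
  unblocks y ys                           ≡⟨ unblocks-blocks w ⟩
  w                                       ∎
  where
  open ≡-Reasoning
  y : Word
  y = proj₁ (blocks w)
  ys : List Word
  ys = proj₂ (blocks w)

weight-unblocks-map : ∀ {f} → (∀ w → weight (f w) ≡ weight w) →
                      ∀ y ys → weight (unblocks (f y) (map f ys)) ≡ weight (unblocks y ys)
weight-unblocks-map {f} weight-f y []        = weight-⁺-cong (f y) y (weight-f y)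
weight-unblocks-map {f} weight-f y (y′ ∷ ys) =
  weight-++-cong (f y ⁺) (y ⁺) (one ∷ rest′) (one ∷ rest)
                 (weight-⁺-cong (f y) y (weight-f y))
                 (weight-∷-cong one rest′ rest (weight-unblocks-map weight-f y′ ys))
  where
  rest′ rest : Word
  rest′ = unblocks (f y′) (map f ys)
  rest  = unblocks y′ ys

weight-mapBlocks : ∀ {f} → (∀ w → weight (f w) ≡ weight w) → ∀ w → weight (mapBlocks f w) ≡ weight w
weight-mapBlocks weight-f w =
  trans (weight-unblocks-map weight-f (proj₁ (blocks w)) (proj₂ (blocks w))) (cong weight (unblocks-blocks w))

Head≤1 : Word → Set
Head≤1 []      = ⊤
Head≤1 (a ∷ _) = a ≤ℙ one

prefixDom-⁺-++ : ∀ u y s → Head≤1 s → PrefixDom (u ⁺) (y ⁺ ++ s) ⇔ PrefixDom u y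
prefixDom-⁺-++ []      y       s       _   = ⇔-id _
prefixDom-⁺-++ (a ∷ u) []      []      _   = ⇔-⊥ (λ ()) (λ ())
prefixDom-⁺-++ (a ∷ u) []      (c ∷ s) c≤1 = ⇔-⊥ (λ (a⁺≤c , _) → succℙ≰one a (≤-trans a⁺≤c c≤1)) (λ ())
prefixDom-⁺-++ (a ∷ u) (b ∷ y) s       h   = ⇔-sym s≤s-⇔ ×-⇔ prefixDom-⁺-++ u y s h

drop-map-++ : ∀ {A B : Set} (f : A → B) k x r → k ≤ length x → drop k (map f x ++ r) ≡ map f (drop k x) ++ r
drop-map-++ f zero    x       r _         = refl
drop-map-++ f (suc k) (a ∷ x) r (s≤s k≤x) = drop-map-++ f k x r k≤x

drop-map-++-∷ : ∀ {A B : Set} (f : A → B) k x b r → length x < k →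
                drop k (map f x ++ b ∷ r) ≡ drop (k ∸ suc (length x)) r
drop-map-++-∷ f (suc k) []      b r _         = refl
drop-map-++-∷ f (suc k) (a ∷ x) b r (s≤s x<k) = drop-map-++-∷ f k x b r x<k

-- Position k of unblocks y ys lies in block y when k ≤ |y|, and otherwise past the 1 that closes y.
BlockPrefixDom : Word → Word → List Word → ℕ → Set
BlockPrefixDom u y []        k = PrefixDom u (drop k y)
BlockPrefixDom u y (y′ ∷ ys) k = (k ≤ length y × PrefixDom u (drop k y))
                               ⊎ (length y < k × BlockPrefixDom u y′ ys (k ∸ suc (length y)))

⊎-⇔ˡ : ∀ {A B P Q : Set} → A → ¬ B → ((A × P) ⊎ (B × Q)) ⇔ P
⊎-⇔ˡ a ¬b = mk⇔ (λ { (inj₁ (_ , p)) → p ; (inj₂ (b , _)) → ⊥-elim (¬b b) }) (λ p → inj₁ (a , p))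

⊎-⇔ʳ : ∀ {A B P Q : Set} → ¬ A → B → ((A × P) ⊎ (B × Q)) ⇔ Q
⊎-⇔ʳ ¬a b = mk⇔ (λ { (inj₁ (a , _)) → ⊥-elim (¬a a) ; (inj₂ (_ , q)) → q }) (λ q → inj₂ (b , q))

prefixDom-⁺-unblocks : ∀ u y ys k → PrefixDom (u ⁺) (drop k (unblocks y ys)) ⇔ BlockPrefixDom u y ys k
prefixDom-⁺-unblocks u y [] k = begin
  PrefixDom (u ⁺) (drop k (y ⁺))        ≡⟨ cong (PrefixDom (u ⁺)) (drop-map k y) ⟩
  PrefixDom (u ⁺) (drop k y ⁺)          ≡⟨ cong (PrefixDom (u ⁺)) (++-identityʳ (drop k y ⁺)) ⟨
  PrefixDom (u ⁺) (drop k y ⁺ ++ [])    ≈⟨ prefixDom-⁺-++ u (drop k y) [] tt ⟩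
  PrefixDom u (drop k y)                ∎
  where open ⇔-Reasoning
prefixDom-⁺-unblocks u y (y′ ∷ ys) k with k ≤? length y
... | yes k≤y = begin
  PrefixDom (u ⁺) (drop k (y ⁺ ++ one ∷ unblocks y′ ys))   ≡⟨ cong (PrefixDom (u ⁺)) (drop-map-++ succℙ k y _ k≤y) ⟩
  PrefixDom (u ⁺) (drop k y ⁺ ++ one ∷ unblocks y′ ys)     ≈⟨ prefixDom-⁺-++ u (drop k y) _ ≤-refl ⟩
  PrefixDom u (drop k y)                                   ≈⟨ ⊎-⇔ˡ k≤y (≤⇒≯ k≤y) ⟨
  BlockPrefixDom u y (y′ ∷ ys) k                           ∎
  where open ⇔-Reasoning
... | no k≰y = begin
  PrefixDom (u ⁺) (drop k (y ⁺ ++ one ∷ unblocks y′ ys))   ≡⟨ cong (PrefixDom (u ⁺)) (drop-map-++-∷ succℙ k y one _ y<k) ⟩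
  PrefixDom (u ⁺) (drop (k ∸ suc (length y)) (unblocks y′ ys)) ≈⟨ prefixDom-⁺-unblocks u y′ ys (k ∸ suc (length y)) ⟩
  BlockPrefixDom u y′ ys (k ∸ suc (length y))               ≈⟨ ⊎-⇔ʳ k≰y y<k ⟨
  BlockPrefixDom u y (y′ ∷ ys) k                            ∎
  where
  open ⇔-Reasoning
  y<k : length y < k
  y<k = ≰⇒> k≰y

blockPrefixDom-map : ∀ {u v} (f : Word → Word) → (∀ w → length (f w) ≡ length w) →
                     (∀ k w → PrefixDom u (drop k w) ⇔ PrefixDom v (drop k (f w))) →
                     ∀ y ys k → BlockPrefixDom u y ys k ⇔ BlockPrefixDom v (f y) (map f ys) k
blockPrefixDom-map f length-f prefixDom-f y []        k = prefixDom-f k y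
blockPrefixDom-map f length-f prefixDom-f y (y′ ∷ ys) k rewrite length-f y =
  (⇔-id _ ×-⇔ prefixDom-f k y) ⊎-⇔ (⇔-id _ ×-⇔ blockPrefixDom-map f length-f prefixDom-f y′ ys (k ∸ suc (length y)))

⁺-cong : ∀ {u v} → u ≅s v → u ⁺ ≅s v ⁺
⁺-cong {u} {v} e = record
  { to           = mapBlocks E.to
  ; from         = mapBlocks E.from
  ; to-from      = mapBlocks-inverse E.to-from
  ; from-to      = mapBlocks-inverse E.from-to
  ; weight-to    = weight-mapBlocks E.weight-to
  ; prefixDom-to = prefixDom-to
  }
  where
  module E = _≅s_ e

  prefixDom-to : ∀ k w → PrefixDom (u ⁺) (drop k w) ⇔ PrefixDom (v ⁺) (drop k (mapBlocks E.to w))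
  prefixDom-to k w = begin
    PrefixDom (u ⁺) (drop k w)                  ≡⟨ cong (PrefixDom (u ⁺) ∘ drop k) (unblocks-blocks w) ⟨
    PrefixDom (u ⁺) (drop k (unblocks y ys))    ≈⟨ prefixDom-⁺-unblocks u y ys k ⟩
    BlockPrefixDom u y ys k                     ≈⟨ blockPrefixDom-map E.to E.length-to E.prefixDom-to y ys k ⟩
    BlockPrefixDom v (E.to y) (map E.to ys) k   ≈⟨ prefixDom-⁺-unblocks v (E.to y) (map E.to ys) k ⟨
    PrefixDom (v ⁺) (drop k (mapBlocks E.to w)) ∎
    where
    open ⇔-Reasoning
    y : Word
    y = proj₁ (blocks w)
    ys : List Word
    ys = proj₂ (blocks w)

lemma5p1 : (u v : Word) → u ∼s v → (1∷ u ∼s 1∷ v) × (1∷ u ∼s ∷1 v) × (u ⁺ ∼s v ⁺)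
lemma5p1 u v u∼v = ≅s⇒∼s 1u≅1v , ≅s⇒∼s (≅s-trans 1u≅1v (1∷≅s∷1 v)) , ≅s⇒∼s (⁺-cong u≅v)
  where
  u≅v : u ≅s v
  u≅v = ∼s⇒≅s u∼v
  1u≅1v : 1∷ u ≅s 1∷ v
  1u≅1v = 1∷-cong u≅v
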